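{- Let $\ell\in\mathbb N$ and $\alpha_j,\beta_j\in\mathbb N$ for $j=1,\dots,\ell$, and let $\mathbf y(t)=\frac{t}{1-t}$. Then, in $t\mathbb Q[[t,q]]$, $$\mathbf R^{\alpha_1}\mathbf y^{\beta_1}\cdots\mathbf R^{\alpha_\ell}\mathbf y^{\beta_\ell}(t)=\sum_{\substack{j_1\ge\beta_1,\dots,j_\ell\ge\beta_\ell\\ k_1\ge\alpha_1,\dots,k_\ell\ge\alpha_\ell}}\ \prod_{r=1}^{\ell}\left[\binom{j_r-1}{\beta_r-1}\binom{k_r-1}{\alpha_r-1}q^{k_r\sum_{s=r}^{\ell}j_s}t^{j_r}\right].$$
   Context: $t\mathbb Q[[t,q]]$ is the set of formal power series in $t,q$ over $\mathbb Q$ divisible by $t$. For $f$ in it, $\mathbf R[f](t)=\sum_{k\ge1}f(q^kt)$, and $\mathbf R^n$ is the $n$-fold composite. The expression $\mathbf R^{\alpha_1}\mathbf y^{\beta_1}\cdots\mathbf R^{\alpha_\ell}\mathbf y^{\beta_\ell}(t)$ means $\mathbf R^{\alpha_1}\big[\mathbf y^{\beta_1}\cdot\mathbf R^{\alpha_2}\big[\mathbf y^{\beta_2}\cdots\mathbf R^{\alpha_\ell}[\mathbf y^{\beta_\ell}]\cdots\big]\big](t)$, where $\mathbf y^{\beta}$ denotes multiplication by the function $\mathbf y(t)^\beta$ (expanded as a power series in $t$). -}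

module Defs where

open import Data.Nat as ℕ using (ℕ; zero; suc; _∸_; _≤ᵇ_; _≡ᵇ_)
open import Data.Nat.Combinatorics using (_C_)
open import Data.Integer using (+_)
open import Data.Rational using (ℚ; 0ℚ; 1ℚ; _+_; _*_; _/_)
open import Data.List as L using (List; []; _∷_; [_]; concatMap; map; upTo)
open import Data.Bool using (Bool; if_then_else_; _∧_)
open import Data.Product using (_×_; _,_)

-- A formal power series in t, q over ℚ, given by its coefficients:
-- f n m = coefficient of t^n q^m.
Series : Set
Series = ℕ → ℕ → ℚ

ℕtoℚ : ℕ → ℚ
ℕtoℚ n = + n / 1

sumTo : ℕ → (ℕ → ℚ) → ℚ
sumTo zero f = f zero
sumTo (suc n) f = sumTo n f + f (suc n)

_⊛_ : Series → Series → Series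
(f ⊛ g) n m = sumTo n λ a → sumTo m λ b → f a b * g (n ∸ a) (m ∸ b)

one : Series
one zero zero = 1ℚ
one _ _ = 0ℚ

-- y(t) = t/(1-t) = Σ_{n≥1} t^n
y : Series
y zero _ = 0ℚ
y (suc n) zero = 1ℚ
y (suc n) (suc m) = 0ℚ

yPow : ℕ → Series
yPow zero = one
yPow (suc b) = y ⊛ yPow b

-- R[f](t) = Σ_{k≥1} f(q^k t), for f ∈ tℚ[[t,q]].
-- Coefficient of t^n q^m is Σ_{k≥1, kn ≤ m} f_{n, m-kn}; for n ≥ 1 only k ≤ m
-- contribute. The t^0 coefficient is 0 since f is divisible by t.
R : Series → Series
R f zero m = 0ℚ
R f (suc n) m = sumTo m λ k →
  if (1 ≤ᵇ k) ∧ (k ℕ.* suc n ≤ᵇ m) then f (suc n) (m ∸ k ℕ.* suc n) else 0ℚ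

Rpow : ℕ → Series → Series
Rpow zero f = f
Rpow (suc a) f = R (Rpow a f)

-- R^{α1} y^{β1} ⋯ R^{αℓ} y^{βℓ}(t), for the list [(α1,β1), …, (αℓ,βℓ)]
lhs : List (ℕ × ℕ) → Series
lhs [] = one
lhs ((a , b) ∷ ps) = Rpow a (yPow b ⊛ lhs ps)

tuples : ℕ → ℕ → List (List ℕ)
tuples zero B = [ [] ]
tuples (suc l) B = concatMap (λ x → map (x ∷_) (tuples l B)) (upTo (suc B))

sumℕ : List ℕ → ℕ
sumℕ = L.foldr ℕ._+_ 0

expQ : List ℕ → List ℕ → ℕ
expQ (j ∷ js) (k ∷ ks) = k ℕ.* (j ℕ.+ sumℕ js) ℕ.+ expQ js ks
expQ _ _ = 0

weight : List (ℕ × ℕ) → List ℕ → List ℕ → ℚ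
weight [] [] [] = 1ℚ
weight ((a , b) ∷ ps) (j ∷ js) (k ∷ ks) =
  (if (b ≤ᵇ j) ∧ (a ≤ᵇ k)
     then ℕtoℚ (((j ∸ 1) C (b ∸ 1)) ℕ.* ((k ∸ 1) C (a ∸ 1)))
     else 0ℚ) * weight ps js ks
weight _ _ _ = 0ℚ

sumList : List ℚ → ℚ
sumList = L.foldr _+_ 0ℚ

-- Every such tuple has
-- j_r ≤ N (as Σ j = N) and k_r ≤ M (as Σ_{s≥r} j_s ≥ 1), so the
-- enumeration ranges below contain all contributing tuples.
rhs : List (ℕ × ℕ) → Series
rhs ps N M =
  sumList (concatMap (λ js → map (λ ks →
      if (sumℕ js ≡ᵇ N) ∧ (expQ js ks ≡ᵇ M) then weight ps js ks else 0ℚ)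
    (tuples (L.length ps) M)) (tuples (L.length ps) N))

module Submission where

-- Write W c n = [c ≤ n]·C(n-1, c-1), the coefficient of x^n in (x/(1-x))^c.
-- Both sides, as functions F_ps(N, M) of the coefficient of t^N q^M, satisfy
-- the same recursion in ps = (α, β) ∷ ps' (formalised as `peel`):
--   F_ps(N, M) = Σ_{j ≤ N} Σ_{k ≤ M} W β j · W α k · [kN ≤ M] · F_ps'(N - j, M - kN).
-- For the left-hand side this follows from two coefficient formulas, both
-- consequences of the hockey-stick identity Σ_{i < n} W c i = W (c+1) n:
--   * y^β = Σ_j W β j t^j, so multiplying by y^β convolves in the t-degree;
--   * on the t^N part, R^α multiplies by Σ_k W α k q^{kN}  (`R-qConv`).
-- For the right-hand side the recursion comes from splitting off the first
-- coordinates (j, k) of the enumerated index tuples; we enumerate with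
-- arbitrary bounds A ≥ N, B ≥ M, which the recursion may shrink to (N, M);
-- the theorem follows by induction on ps (`rhsBounded≡lhs`).

open import Defs
open import Data.Nat using (ℕ; _≤_)
open import Data.Product using (_×_; _,_; proj₁; proj₂)
open import Data.List using (List; [])
open import Data.List.Relation.Unary.All using (All)
open import Relation.Binary.PropositionalEquality using (_≡_; _≢_)

open import Algebra.Bundles using (CommutativeMonoid)
open import Data.Bool using (true; false; if_then_else_; _∧_)
open import Data.Integer as ℤ using ()
import Data.Integer.Properties as ℤP
open import Data.List as L using (_∷_; concatMap; map; applyUpTo; _++_)
import Data.List.Properties as LP
open import Data.List.Relation.Unary.All using (_∷_)
open import Data.Nat as ℕ using (zero; suc; _∸_; _≤ᵇ_; _≡ᵇ_; _<_; z≤n; s≤s)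
open import Data.Nat.Combinatorics using (_C_; k>n⇒nCk≡0; nCk+nC[k+1]≡[n+1]C[k+1])
import Data.Nat.Coprimality as Coprime
import Data.Nat.Properties as ℕP
open import Data.Rational as ℚ using (ℚ; 0ℚ; 1ℚ; _+_; _*_)
import Data.Rational.Properties as QP
import Data.Rational.Unnormalised as U
import Data.Rational.Unnormalised.Properties as UP
open import Data.Sum using (inj₁; inj₂)
open import Function.Bundles using (mk⇔)
open import Relation.Binary.PropositionalEquality
  using (refl; sym; trans; cong; cong₂; subst; module ≡-Reasoning)
open import Relation.Nullary using (yes; no)
open import Relation.Nullary.Decidable using (dec-true; dec-false; does-⇔; _×-dec_)

open import Algebra.Properties.CommutativeSemigroup
  (CommutativeMonoid.commutativeSemigroup QP.+-0-commutativeMonoid)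
  using (interchange)
open import Algebra.Properties.CommutativeSemigroup
  (CommutativeMonoid.commutativeSemigroup QP.*-1-commutativeMonoid)
  using (x∙yz≈yx∙z)

toℚᵘ-ℕtoℚ : ∀ n → ℚ.toℚᵘ (ℕtoℚ n) ≡ U.mkℚᵘ (ℤ.+ n) 0
toℚᵘ-ℕtoℚ n = cong ℚ.toℚᵘ (QP.normalize-coprime (Coprime.sym (Coprime.1-coprimeTo n)))

ℕtoℚ-+ : ∀ m n → ℕtoℚ (m ℕ.+ n) ≡ ℕtoℚ m + ℕtoℚ n
ℕtoℚ-+ m n = QP.toℚᵘ-injective (begin
  ℚ.toℚᵘ (ℕtoℚ (m ℕ.+ n))               ≡⟨ toℚᵘ-ℕtoℚ (m ℕ.+ n) ⟩
  U.mkℚᵘ (ℤ.+ (m ℕ.+ n)) 0               ≈⟨ U.*≡* (cong (ℤ._* ℤ.+ 1) numerators) ⟩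
  U.mkℚᵘ (ℤ.+ m) 0 U.+ U.mkℚᵘ (ℤ.+ n) 0  ≡⟨ sym (cong₂ U._+_ (toℚᵘ-ℕtoℚ m) (toℚᵘ-ℕtoℚ n)) ⟩
  ℚ.toℚᵘ (ℕtoℚ m) U.+ ℚ.toℚᵘ (ℕtoℚ n)   ≈⟨ UP.≃-sym (QP.toℚᵘ-homo-+ (ℕtoℚ m) (ℕtoℚ n)) ⟩
  ℚ.toℚᵘ (ℕtoℚ m + ℕtoℚ n)               ∎)
  where
  open UP.≃-Reasoning
  numerators : ℤ.+ (m ℕ.+ n) ≡ ℤ.+ m ℤ.* ℤ.+ 1 ℤ.+ ℤ.+ n ℤ.* ℤ.+ 1
  numerators = trans (ℤP.pos-+ m n)
    (sym (cong₂ ℤ._+_ (ℤP.*-identityʳ (ℤ.+ m)) (ℤP.*-identityʳ (ℤ.+ n))))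

ℕtoℚ-* : ∀ m n → ℕtoℚ (m ℕ.* n) ≡ ℕtoℚ m * ℕtoℚ n
ℕtoℚ-* m n = QP.toℚᵘ-injective (begin
  ℚ.toℚᵘ (ℕtoℚ (m ℕ.* n))               ≡⟨ toℚᵘ-ℕtoℚ (m ℕ.* n) ⟩
  U.mkℚᵘ (ℤ.+ (m ℕ.* n)) 0               ≈⟨ U.*≡* (cong (ℤ._* ℤ.+ 1) (ℤP.pos-* m n)) ⟩
  U.mkℚᵘ (ℤ.+ m) 0 U.* U.mkℚᵘ (ℤ.+ n) 0  ≡⟨ sym (cong₂ U._*_ (toℚᵘ-ℕtoℚ m) (toℚᵘ-ℕtoℚ n)) ⟩
  ℚ.toℚᵘ (ℕtoℚ m) U.* ℚ.toℚᵘ (ℕtoℚ n)   ≈⟨ UP.≃-sym (QP.toℚᵘ-homo-* (ℕtoℚ m) (ℕtoℚ n)) ⟩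
  ℚ.toℚᵘ (ℕtoℚ m * ℕtoℚ n)               ∎)
  where open UP.≃-Reasoning

≤ᵇ-true : ∀ {m n} → m ≤ n → (m ≤ᵇ n) ≡ true
≤ᵇ-true {m} {n} = dec-true (m ℕP.≤? n)

≤ᵇ-false : ∀ {m n} → n < m → (m ≤ᵇ n) ≡ false
≤ᵇ-false {m} {n} n<m = dec-false (m ℕP.≤? n) (ℕP.<⇒≱ n<m)

≤ᵇ-suc : ∀ j K → (suc j ≤ᵇ suc K) ≡ (j ≤ᵇ K)
≤ᵇ-suc zero    K = refl
≤ᵇ-suc (suc j) K = refl

≤ᵇ-∸ : ∀ x y M → x ≤ M → (y ≤ᵇ M ∸ x) ≡ (x ℕ.+ y ≤ᵇ M)
≤ᵇ-∸ x y M x≤M = does-⇔ (mk⇔ to from) (y ℕP.≤? M ∸ x) (x ℕ.+ y ℕP.≤? M)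
  where
  to : y ≤ M ∸ x → x ℕ.+ y ≤ M
  to y≤M∸x = subst (_≤ M) (ℕP.+-comm y x) (ℕP.m≤o∸n⇒m+n≤o y x≤M y≤M∸x)
  from : x ℕ.+ y ≤ M → y ≤ M ∸ x
  from x+y≤M = ℕP.m+n≤o⇒m≤o∸n y (subst (_≤ M) (ℕP.+-comm x y) x+y≤M)

*-if : ∀ (w : ℚ) c x → w * (if c then x else 0ℚ) ≡ (if c then w * x else 0ℚ)
*-if w true  x = refl
*-if w false x = QP.*-zeroʳ w

if-∧ : ∀ c d (x : ℚ) → (if c ∧ d then x else 0ℚ) ≡ (if c then (if d then x else 0ℚ) else 0ℚ)
if-∧ true  d x = refl
if-∧ false d x = refl

sumTo-cong : ∀ n {f g : ℕ → ℚ} → (∀ i → i ≤ n → f i ≡ g i) → sumTo n f ≡ sumTo n g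
sumTo-cong zero    f≗g = f≗g 0 z≤n
sumTo-cong (suc n) f≗g =
  cong₂ _+_ (sumTo-cong n (λ i i≤n → f≗g i (ℕP.m≤n⇒m≤1+n i≤n))) (f≗g (suc n) ℕP.≤-refl)

sumTo-zero : ∀ n {f : ℕ → ℚ} → (∀ i → i ≤ n → f i ≡ 0ℚ) → sumTo n f ≡ 0ℚ
sumTo-zero n {f} f≗0 = trans (sumTo-cong n f≗0) (zeros n)
  where
  zeros : ∀ n → sumTo n (λ _ → 0ℚ) ≡ 0ℚ
  zeros zero    = refl
  zeros (suc n) = trans (cong (_+ 0ℚ) (zeros n)) (QP.+-identityʳ 0ℚ)

sumTo-+ : ∀ n (f g : ℕ → ℚ) → sumTo n (λ i → f i + g i) ≡ sumTo n f + sumTo n g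
sumTo-+ zero    f g = refl
sumTo-+ (suc n) f g = trans (cong (_+ (f (suc n) + g (suc n))) (sumTo-+ n f g))
  (interchange (sumTo n f) (sumTo n g) (f (suc n)) (g (suc n)))

sumTo-*ˡ : ∀ n c (f : ℕ → ℚ) → c * sumTo n f ≡ sumTo n (λ i → c * f i)
sumTo-*ˡ zero    c f = refl
sumTo-*ˡ (suc n) c f =
  trans (QP.*-distribˡ-+ c (sumTo n f) (f (suc n))) (cong (_+ c * f (suc n)) (sumTo-*ˡ n c f))

sumTo-*ʳ : ∀ n c (f : ℕ → ℚ) → sumTo n f * c ≡ sumTo n (λ i → f i * c)
sumTo-*ʳ n c f = trans (QP.*-comm (sumTo n f) c)
  (trans (sumTo-*ˡ n c f) (sumTo-cong n (λ i _ → QP.*-comm c (f i))))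

sumTo-swap : ∀ n m (f : ℕ → ℕ → ℚ) →
  sumTo n (λ i → sumTo m (f i)) ≡ sumTo m (λ j → sumTo n (λ i → f i j))
sumTo-swap zero    m f = refl
sumTo-swap (suc n) m f = trans (cong (_+ sumTo m (f (suc n))) (sumTo-swap n m f))
  (sym (sumTo-+ m (λ j → sumTo n (λ i → f i j)) (f (suc n))))

sumTo-head : ∀ n (f : ℕ → ℚ) → sumTo (suc n) f ≡ f 0 + sumTo n (λ i → f (suc i))
sumTo-head zero    f = refl
sumTo-head (suc n) f =
  trans (cong (_+ f (suc (suc n))) (sumTo-head n f)) (QP.+-assoc (f 0) _ _)

sumTo-reverse : ∀ n (f : ℕ → ℚ) → sumTo n (λ i → f (n ∸ i)) ≡ sumTo n f
sumTo-reverse zero    f = refl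
sumTo-reverse (suc n) f = trans (sumTo-head n (λ i → f (suc n ∸ i)))
  (trans (cong (f (suc n) +_) (sumTo-reverse n f)) (QP.+-comm (f (suc n)) (sumTo n f)))

sumTo-first : ∀ n (f : ℕ → ℚ) → (∀ i → 1 ≤ i → f i ≡ 0ℚ) → sumTo n f ≡ f 0
sumTo-first zero    f f≗0 = refl
sumTo-first (suc n) f f≗0 =
  trans (cong₂ _+_ (sumTo-first n f f≗0) (f≗0 (suc n) (s≤s z≤n))) (QP.+-identityʳ (f 0))

sumTo-extend : ∀ {n} m (f : ℕ → ℚ) → n ≤ m → (∀ i → n < i → i ≤ m → f i ≡ 0ℚ) →
  sumTo m f ≡ sumTo n f
sumTo-extend m f n≤m tail≗0 with ℕP.m≤n⇒m<n∨m≡n n≤m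
... | inj₂ refl = refl
sumTo-extend {n} (suc m) f _ tail≗0 | inj₁ (s≤s n≤m) = trans
  (cong₂ _+_ (sumTo-extend m f n≤m (λ i n<i i≤m → tail≗0 i n<i (ℕP.m≤n⇒m≤1+n i≤m)))
             (tail≗0 (suc m) (s≤s n≤m) ℕP.≤-refl))
  (QP.+-identityʳ (sumTo n f))

sumTo-guardˡ : ∀ K L (g : ℕ → ℚ) → K ≤ L →
  sumTo L (λ j → if j ≤ᵇ K then g j else 0ℚ) ≡ sumTo K g
sumTo-guardˡ K L g K≤L = trans
  (sumTo-extend L _ K≤L (λ i K<i _ → cong (λ c → if c then g i else 0ℚ) (≤ᵇ-false K<i)))
  (sumTo-cong K (λ j j≤K → cong (λ c → if c then g j else 0ℚ) (≤ᵇ-true j≤K)))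

sumTo-guardʳ : ∀ j L (F : ℕ → ℚ) → j ≤ L →
  sumTo L (λ K → if j ≤ᵇ K then F K else 0ℚ) ≡ sumTo (L ∸ j) (λ k → F (j ℕ.+ k))
sumTo-guardʳ zero    L       F _         = refl
sumTo-guardʳ (suc j) (suc L) F (s≤s j≤L) = begin
  sumTo (suc L) (λ K → if suc j ≤ᵇ K then F K else 0ℚ)
    ≡⟨ sumTo-head L (λ K → if suc j ≤ᵇ K then F K else 0ℚ) ⟩
  0ℚ + sumTo L (λ K → if suc j ≤ᵇ suc K then F (suc K) else 0ℚ)
    ≡⟨ QP.+-identityˡ _ ⟩
  sumTo L (λ K → if suc j ≤ᵇ suc K then F (suc K) else 0ℚ)
    ≡⟨ sumTo-cong L (λ K _ → cong (λ c → if c then F (suc K) else 0ℚ) (≤ᵇ-suc j K)) ⟩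
  sumTo L (λ K → if j ≤ᵇ K then F (suc K) else 0ℚ)
    ≡⟨ sumTo-guardʳ j L (λ K → F (suc K)) j≤L ⟩
  sumTo (L ∸ j) (λ k → F (suc j ℕ.+ k)) ∎
  where open ≡-Reasoning

sumBelow : (ℕ → ℚ) → ℕ → ℚ
sumBelow h zero    = 0ℚ
sumBelow h (suc n) = sumTo n h

sumBelow-cong : ∀ n {f g : ℕ → ℚ} → (∀ i → f i ≡ g i) → sumBelow f n ≡ sumBelow g n
sumBelow-cong zero    f≗g = refl
sumBelow-cong (suc n) f≗g = sumTo-cong n (λ i _ → f≗g i)

sumTo-reindex : ∀ (w Φ : ℕ → ℚ) L → (∀ K → L < K → Φ K ≡ 0ℚ) →
  sumTo L (λ k → sumTo L (λ j → w j * Φ (k ℕ.+ j))) ≡ sumTo L (λ K → sumTo K w * Φ K)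
sumTo-reindex w Φ L Φ-support = begin
  sumTo L (λ k → sumTo L (λ j → w j * Φ (k ℕ.+ j)))
    ≡⟨ sumTo-swap L L (λ k j → w j * Φ (k ℕ.+ j)) ⟩
  sumTo L (λ j → sumTo L (λ k → w j * Φ (k ℕ.+ j)))
    ≡⟨ sumTo-cong L (λ j j≤L → trans (sym (sumTo-*ˡ L (w j) (λ k → Φ (k ℕ.+ j))))
                                     (cong (w j *_) (shifted j j≤L))) ⟩
  sumTo L (λ j → w j * sumTo L (λ K → if j ≤ᵇ K then Φ K else 0ℚ))
    ≡⟨ sumTo-cong L (λ j _ → trans (sumTo-*ˡ L (w j) _)
                                   (sumTo-cong L (λ K _ → *-if (w j) (j ≤ᵇ K) (Φ K)))) ⟩
  sumTo L (λ j → sumTo L (λ K → if j ≤ᵇ K then w j * Φ K else 0ℚ))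
    ≡⟨ sumTo-swap L L (λ j K → if j ≤ᵇ K then w j * Φ K else 0ℚ) ⟩
  sumTo L (λ K → sumTo L (λ j → if j ≤ᵇ K then w j * Φ K else 0ℚ))
    ≡⟨ sumTo-cong L (λ K K≤L → sumTo-guardˡ K L (λ j → w j * Φ K) K≤L) ⟩
  sumTo L (λ K → sumTo K (λ j → w j * Φ K))
    ≡⟨ sumTo-cong L (λ K _ → sym (sumTo-*ʳ K (Φ K) w)) ⟩
  sumTo L (λ K → sumTo K w * Φ K) ∎
  where
  open ≡-Reasoning
  shifted : ∀ j → j ≤ L →
    sumTo L (λ k → Φ (k ℕ.+ j)) ≡ sumTo L (λ K → if j ≤ᵇ K then Φ K else 0ℚ)
  shifted j j≤L = begin
    sumTo L (λ k → Φ (k ℕ.+ j))       ≡⟨ sumTo-cong L (λ k _ → cong Φ (ℕP.+-comm k j)) ⟩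
    sumTo L (λ k → Φ (j ℕ.+ k))       ≡⟨ sumTo-extend L (λ k → Φ (j ℕ.+ k)) (ℕP.m∸n≤m L j)
                                           (λ i L∸j<i _ → Φ-support (j ℕ.+ i) (beyond i L∸j<i)) ⟩
    sumTo (L ∸ j) (λ k → Φ (j ℕ.+ k)) ≡⟨ sym (sumTo-guardʳ j L Φ j≤L) ⟩
    sumTo L (λ K → if j ≤ᵇ K then Φ K else 0ℚ) ∎
    where
    beyond : ∀ i → L ∸ j < i → L < j ℕ.+ i
    beyond i L∸j<i = subst (_< j ℕ.+ i) (ℕP.m+[n∸m]≡n j≤L) (ℕP.+-monoʳ-< j L∸j<i)

sumTo-reindex₁ : ∀ (w Φ : ℕ → ℚ) L → (∀ K → L < K → Φ K ≡ 0ℚ) →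
  sumTo L (λ k → if 1 ≤ᵇ k then sumTo L (λ j → w j * Φ (k ℕ.+ j)) else 0ℚ)
    ≡ sumTo L (λ K → sumBelow w K * Φ K)
sumTo-reindex₁ w Φ zero    _         = sym (QP.*-zeroˡ (Φ 0))
sumTo-reindex₁ w Φ (suc L) Φ-support = begin
  sumTo (suc L) (λ k → if 1 ≤ᵇ k then sumTo (suc L) (λ j → w j * Φ (k ℕ.+ j)) else 0ℚ)
    ≡⟨ sumTo-head L _ ⟩
  0ℚ + sumTo L (λ k → sumTo (suc L) (λ j → w j * Φ (suc (k ℕ.+ j))))
    ≡⟨ QP.+-identityˡ _ ⟩
  sumTo L (λ k → sumTo L (λ j → w j * Φ (suc (k ℕ.+ j))) + w (suc L) * Φ (suc (k ℕ.+ suc L)))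
    ≡⟨ sumTo-cong L (λ k _ → trans (cong (sumTo L (λ j → w j * Φ (suc (k ℕ.+ j))) +_) (last-vanishes k))
                                   (QP.+-identityʳ _)) ⟩
  sumTo L (λ k → sumTo L (λ j → w j * Φ (suc (k ℕ.+ j))))
    ≡⟨ sumTo-reindex w (λ K → Φ (suc K)) L (λ K L<K → Φ-support (suc K) (s≤s L<K)) ⟩
  sumTo L (λ K → sumTo K w * Φ (suc K))
    ≡⟨ sym (QP.+-identityˡ _) ⟩
  0ℚ + sumTo L (λ K → sumTo K w * Φ (suc K))
    ≡⟨ cong (_+ sumTo L (λ K → sumTo K w * Φ (suc K))) (sym (QP.*-zeroˡ (Φ 0))) ⟩
  0ℚ * Φ 0 + sumTo L (λ K → sumTo K w * Φ (suc K))
    ≡⟨ sym (sumTo-head L (λ K → sumBelow w K * Φ K)) ⟩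
  sumTo (suc L) (λ K → sumBelow w K * Φ K) ∎
  where
  open ≡-Reasoning
  last-vanishes : ∀ k → w (suc L) * Φ (suc (k ℕ.+ suc L)) ≡ 0ℚ
  last-vanishes k = trans (cong (w (suc L) *_) (Φ-support _ (s≤s (ℕP.m≤n+m (suc L) k))))
                          (QP.*-zeroʳ (w (suc L)))

-- W c n = [c ≤ n]·C(n-1, c-1), the coefficient of x^n in (x/(1-x))^c for c ≥ 1.
W : ℕ → ℕ → ℚ
W c n = ℕtoℚ (if c ≤ᵇ n then (n ∸ 1) C (c ∸ 1) else 0)

W-suc : ∀ d n → W (suc d) (suc n) ≡ ℕtoℚ (n C d)
W-suc d n with d ℕP.≤? n
... | yes d≤n rewrite ≤ᵇ-true (s≤s d≤n) = refl
... | no  d≰n rewrite ≤ᵇ-false (s≤s (ℕP.≰⇒> d≰n)) =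
  cong ℕtoℚ (sym (k>n⇒nCk≡0 (ℕP.≰⇒> d≰n)))

-- The hockey-stick identity  C(n, d+1) = Σ_{i < n} C(i-1, d), i.e.
-- x/(1-x) · (x/(1-x))^{d+1} = (x/(1-x))^{d+2} on coefficients.
W-hockey : ∀ d K → W (suc (suc d)) K ≡ sumBelow (W (suc d)) K
W-hockey d zero          = refl
W-hockey d (suc zero)    = refl
W-hockey d (suc (suc n)) = begin
  W (suc (suc d)) (suc (suc n))                  ≡⟨ W-suc (suc d) (suc n) ⟩
  ℕtoℚ (suc n C suc d)                           ≡⟨ cong ℕtoℚ (sym (nCk+nC[k+1]≡[n+1]C[k+1] n d)) ⟩
  ℕtoℚ (n C d ℕ.+ n C suc d)                     ≡⟨ ℕtoℚ-+ (n C d) (n C suc d) ⟩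
  ℕtoℚ (n C d) + ℕtoℚ (n C suc d)                ≡⟨ QP.+-comm (ℕtoℚ (n C d)) (ℕtoℚ (n C suc d)) ⟩
  ℕtoℚ (n C suc d) + ℕtoℚ (n C d)                ≡⟨ cong₂ _+_ (sym (W-suc (suc d) n)) (sym (W-suc d n)) ⟩
  W (suc (suc d)) (suc n) + W (suc d) (suc n)    ≡⟨ cong (_+ W (suc d) (suc n)) (W-hockey d (suc n)) ⟩
  sumTo n (W (suc d)) + W (suc d) (suc n)        ∎
  where open ≡-Reasoning

weight-cons : ∀ a b ps j k js ks →
  weight ((a , b) ∷ ps) (j ∷ js) (k ∷ ks) ≡ (W b j * W a k) * weight ps js ks
weight-cons a b ps j k js ks = cong (_* weight ps js ks) (pair (b ≤ᵇ j) (a ≤ᵇ k))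
  where
  pair : ∀ u v → (if u ∧ v then ℕtoℚ (((j ∸ 1) C (b ∸ 1)) ℕ.* ((k ∸ 1) C (a ∸ 1))) else 0ℚ)
                   ≡ ℕtoℚ (if u then (j ∸ 1) C (b ∸ 1) else 0)
                     * ℕtoℚ (if v then (k ∸ 1) C (a ∸ 1) else 0)
  pair true  true  = ℕtoℚ-* ((j ∸ 1) C (b ∸ 1)) ((k ∸ 1) C (a ∸ 1))
  pair true  false = sym (QP.*-zeroʳ (ℕtoℚ ((j ∸ 1) C (b ∸ 1))))
  pair false v     = sym (QP.*-zeroˡ (ℕtoℚ (if v then (k ∸ 1) C (a ∸ 1) else 0)))

tSeries : (ℕ → ℚ) → Series
tSeries f n zero    = f n
tSeries f n (suc m) = 0ℚ

⊛-congˡ : ∀ {f f' : Series} (g : Series) → (∀ n m → f n m ≡ f' n m) →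
  ∀ n m → (f ⊛ g) n m ≡ (f' ⊛ g) n m
⊛-congˡ g f≗f' n m =
  sumTo-cong n (λ a _ → sumTo-cong m (λ b _ → cong (_* g (n ∸ a) (m ∸ b)) (f≗f' a b)))

tSeries-⊛ : ∀ f (h : Series) N M → (tSeries f ⊛ h) N M ≡ sumTo N (λ j → f j * h (N ∸ j) M)
tSeries-⊛ f h N M = sumTo-cong N (λ j _ → sumTo-first M _ λ where
  (suc i) _ → QP.*-zeroˡ (h (N ∸ j) (M ∸ suc i)))

y-tSeries : ∀ n m → y n m ≡ tSeries (W 1) n m
y-tSeries zero    zero    = refl
y-tSeries zero    (suc m) = refl
y-tSeries (suc n) zero    = refl
y-tSeries (suc n) (suc m) = refl

y-⊛ : ∀ (g : Series) n m → (y ⊛ g) n m ≡ sumBelow (λ i → g i m) n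
y-⊛ g n m = trans (⊛-congˡ g y-tSeries n m) (trans (tSeries-⊛ (W 1) g n m) (partial n))
  where
  open ≡-Reasoning
  partial : ∀ n → sumTo n (λ j → W 1 j * g (n ∸ j) m) ≡ sumBelow (λ i → g i m) n
  partial zero    = QP.*-zeroˡ (g 0 m)
  partial (suc n) = begin
    sumTo (suc n) (λ j → W 1 j * g (suc n ∸ j) m)
      ≡⟨ sumTo-head n (λ j → W 1 j * g (suc n ∸ j) m) ⟩
    0ℚ * g (suc n) m + sumTo n (λ i → 1ℚ * g (n ∸ i) m)
      ≡⟨ cong₂ _+_ (QP.*-zeroˡ (g (suc n) m)) (sumTo-cong n (λ i _ → QP.*-identityˡ (g (n ∸ i) m))) ⟩
    0ℚ + sumTo n (λ i → g (n ∸ i) m)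
      ≡⟨ QP.+-identityˡ _ ⟩
    sumTo n (λ i → g (n ∸ i) m)
      ≡⟨ sumTo-reverse n (λ i → g i m) ⟩
    sumTo n (λ i → g i m) ∎

yPow-tSeries : ∀ d n m → yPow (suc d) n m ≡ tSeries (W (suc d)) n m
yPow-tSeries zero n m = trans (y-⊛ one n m) (ones n m)
  where
  ones : ∀ n m → sumBelow (λ i → one i m) n ≡ tSeries (W 1) n m
  ones zero    zero    = refl
  ones zero    (suc m) = refl
  ones (suc n) zero    = sumTo-first n (λ i → one i zero) λ where (suc i) _ → refl
  ones (suc n) (suc m) = sumTo-first n (λ i → one i (suc m)) λ where (suc i) _ → refl
yPow-tSeries (suc d) n m = begin
  (y ⊛ yPow (suc d)) n m                             ≡⟨ y-⊛ (yPow (suc d)) n m ⟩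
  sumBelow (λ i → yPow (suc d) i m) n               ≡⟨ sumBelow-cong n (λ i → yPow-tSeries d i m) ⟩
  sumBelow (λ i → tSeries (W (suc d)) i m) n        ≡⟨ hockey n m ⟩
  tSeries (W (suc (suc d))) n m                     ∎
  where
  open ≡-Reasoning
  hockey : ∀ n m → sumBelow (λ i → tSeries (W (suc d)) i m) n ≡ tSeries (W (suc (suc d))) n m
  hockey n       zero    = sym (W-hockey d n)
  hockey zero    (suc m) = refl
  hockey (suc n) (suc m) = sumTo-zero n (λ _ _ → refl)

-- For a fixed t-degree N, view g as the q-series Σ_m g m q^m.
-- qShift N g m k is the coefficient of q^m in q^{kN}·g(q), and qConv N w g
-- the coefficient of q^m in (Σ_k w k q^{kN})·g(q).

qShift : ℕ → (ℕ → ℚ) → ℕ → ℕ → ℚ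
qShift N g m k = if k ℕ.* N ≤ᵇ m then g (m ∸ k ℕ.* N) else 0ℚ

qConv : ℕ → (ℕ → ℚ) → (ℕ → ℚ) → ℕ → ℚ
qConv N w g m = sumTo m (λ k → w k * qShift N g m k)

qShift-vanish : ∀ N g M K → M < K ℕ.* N → qShift N g M K ≡ 0ℚ
qShift-vanish N g M K M<KN rewrite ≤ᵇ-false M<KN = refl

qShift-qShift : ∀ N g M k k' → k ℕ.* N ≤ M → qShift N g (M ∸ k ℕ.* N) k' ≡ qShift N g M (k ℕ.+ k')
qShift-qShift N g M k k' kN≤M
  rewrite ℕP.*-distribʳ-+ N k k' | ℕP.∸-+-assoc M (k ℕ.* N) (k' ℕ.* N)
        | ≤ᵇ-∸ (k ℕ.* N) (k' ℕ.* N) M kN≤M = refl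

if-sumTo : ∀ c n (a f : ℕ → ℚ) →
  (if c then sumTo n (λ j → a j * f j) else 0ℚ) ≡ sumTo n (λ j → a j * (if c then f j else 0ℚ))
if-sumTo true  n a f = refl
if-sumTo false n a f = sym (sumTo-zero n (λ j _ → QP.*-zeroʳ (a j)))

beyond-window : ∀ N .{{_ : ℕ.NonZero N}} M k i →
  k ℕ.* N ≤ M → M ∸ k ℕ.* N < i → M < (k ℕ.+ i) ℕ.* N
beyond-window N M k i kN≤M M∸kN<i = begin-strict
  M                         ≡⟨ ℕP.m+[n∸m]≡n kN≤M ⟨
  k ℕ.* N ℕ.+ (M ∸ k ℕ.* N) <⟨ ℕP.+-monoʳ-< (k ℕ.* N) M∸kN<i ⟩
  k ℕ.* N ℕ.+ i             ≤⟨ ℕP.+-monoʳ-≤ (k ℕ.* N) (ℕP.m≤m*n i N) ⟩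
  k ℕ.* N ℕ.+ i ℕ.* N       ≡⟨ ℕP.*-distribʳ-+ N k i ⟨
  (k ℕ.+ i) ℕ.* N           ∎
  where open ℕP.≤-Reasoning

-- Shifting by q^{kN} commutes with the spaced convolution; the sum over k'
-- may be taken up to M since (k + k')N > M for the extra terms.
qShift-qConv : ∀ N .{{_ : ℕ.NonZero N}} w g M k →
  qShift N (qConv N w g) M k ≡ sumTo M (λ k' → w k' * qShift N g M (k ℕ.+ k'))
qShift-qConv N w g M k with k ℕ.* N ℕP.≤? M
... | no kN≰M rewrite ≤ᵇ-false (ℕP.≰⇒> kN≰M) = sym (sumTo-zero M λ i _ →
  trans (cong (w i *_) (qShift-vanish N g M (k ℕ.+ i)
                         (ℕP.<-≤-trans (ℕP.≰⇒> kN≰M) (ℕP.*-monoˡ-≤ N (ℕP.m≤m+n k i)))))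
        (QP.*-zeroʳ (w i)))
... | yes kN≤M rewrite ≤ᵇ-true kN≤M = begin
  sumTo (M ∸ k ℕ.* N) (λ k' → w k' * qShift N g (M ∸ k ℕ.* N) k')
    ≡⟨ sumTo-cong (M ∸ k ℕ.* N) (λ k' _ → cong (w k' *_) (qShift-qShift N g M k k' kN≤M)) ⟩
  sumTo (M ∸ k ℕ.* N) (λ k' → w k' * qShift N g M (k ℕ.+ k'))
    ≡⟨ sym (sumTo-extend M _ (ℕP.m∸n≤m M (k ℕ.* N)) (λ i M∸kN<i _ →
         trans (cong (w i *_) (qShift-vanish N g M (k ℕ.+ i) (beyond-window N M k i kN≤M M∸kN<i)))
               (QP.*-zeroʳ (w i)))) ⟩
  sumTo M (λ k' → w k' * qShift N g M (k ℕ.+ k')) ∎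
  where open ≡-Reasoning

-- Coefficients of R^{d+1}: on the t^N part, R^{d+1} multiplies by
-- Σ_k C(k-1, d) q^{kN} = (q^N/(1-q^N))^{d+1}.
R-qConv : ∀ d (G : Series) n M →
  Rpow (suc d) G (suc n) M ≡ qConv (suc n) (W (suc d)) (G (suc n)) M
R-qConv zero G n M = sumTo-cong M (λ k _ → single k)
  where
  single : ∀ k → (if (1 ≤ᵇ k) ∧ (k ℕ.* suc n ≤ᵇ M) then G (suc n) (M ∸ k ℕ.* suc n) else 0ℚ)
                 ≡ W 1 k * qShift (suc n) (G (suc n)) M k
  single zero    = sym (QP.*-zeroˡ (qShift (suc n) (G (suc n)) M 0))
  single (suc k) = sym (QP.*-identityˡ (qShift (suc n) (G (suc n)) M (suc k)))
R-qConv (suc d) G n M = begin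
  Rpow (suc (suc d)) G N M
    ≡⟨ sumTo-cong M (λ k _ → iterate k) ⟩
  sumTo M (λ k → if 1 ≤ᵇ k then qShift N (qConv N w g) M k else 0ℚ)
    ≡⟨ sumTo-cong M (λ k _ → cong (λ z → if 1 ≤ᵇ k then z else 0ℚ) (qShift-qConv N w g M k)) ⟩
  sumTo M (λ k → if 1 ≤ᵇ k then sumTo M (λ k' → w k' * qShift N g M (k ℕ.+ k')) else 0ℚ)
    ≡⟨ sumTo-reindex₁ w (qShift N g M) M (λ K M<K →
         qShift-vanish N g M K (ℕP.<-≤-trans M<K (ℕP.m≤m*n K N))) ⟩
  sumTo M (λ K → sumBelow w K * qShift N g M K)
    ≡⟨ sumTo-cong M (λ K _ → cong (_* qShift N g M K) (sym (W-hockey d K))) ⟩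
  qConv N (W (suc (suc d))) g M ∎
  where
  open ≡-Reasoning
  N = suc n
  w = W (suc d)
  g = G N
  iterate : ∀ k → (if (1 ≤ᵇ k) ∧ (k ℕ.* N ≤ᵇ M) then Rpow (suc d) G N (M ∸ k ℕ.* N) else 0ℚ)
                  ≡ (if 1 ≤ᵇ k then qShift N (qConv N w g) M k else 0ℚ)
  iterate zero    = refl
  iterate (suc k) = cong (λ z → if suc k ℕ.* N ≤ᵇ M then z else 0ℚ) (R-qConv d G n (M ∸ suc k ℕ.* N))

-- The recursion shared by both sides of the theorem: the first pair (a, b) of
-- exponents contributes W b j · W a k · t^j q^{kN} for indices j ≤ A, k ≤ B,
-- and the remaining pairs contribute the coefficient h (N ∸ j) (M ∸ kN).
peel : ℕ → ℕ → ℕ → ℕ → Series → Series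
peel A B a b h N M = sumTo A (λ j → sumTo B (λ k → (W b j * W a k) *
  (if (j ≤ᵇ N) ∧ (k ℕ.* N ≤ᵇ M) then h (N ∸ j) (M ∸ k ℕ.* N) else 0ℚ)))

lhs-peel : ∀ a' b' (h : Series) N M →
  Rpow (suc a') (yPow (suc b') ⊛ h) N M ≡ peel N M (suc a') (suc b') h N M
lhs-peel a' b' h zero    M = sym (sumTo-zero M (λ k _ →
  trans (cong (_* qShift 0 (h 0) M k) (QP.*-zeroˡ (W (suc a') k))) (QP.*-zeroˡ (qShift 0 (h 0) M k))))
lhs-peel a' b' h (suc n) M = begin
  Rpow a G N M
    ≡⟨ R-qConv a' G n M ⟩
  sumTo M (λ k → W a k * qShift N (G N) M k)
    ≡⟨ sumTo-cong M (λ k _ → cong (W a k *_) (cong (λ z → if k ℕ.* N ≤ᵇ M then z else 0ℚ)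
                                                  (first-factor (M ∸ k ℕ.* N)))) ⟩
  sumTo M (λ k → W a k * qShift N (λ m → sumTo N (λ j → W b j * h (N ∸ j) m)) M k)
    ≡⟨ sumTo-cong M (λ k _ → cong (W a k *_)
         (if-sumTo (k ℕ.* N ≤ᵇ M) N (W b) (λ j → h (N ∸ j) (M ∸ k ℕ.* N)))) ⟩
  sumTo M (λ k → W a k * sumTo N (λ j → W b j * qShift N (h (N ∸ j)) M k))
    ≡⟨ sumTo-cong M (λ k _ → sumTo-*ˡ N (W a k) _) ⟩
  sumTo M (λ k → sumTo N (λ j → W a k * (W b j * qShift N (h (N ∸ j)) M k)))
    ≡⟨ sumTo-swap M N _ ⟩
  sumTo N (λ j → sumTo M (λ k → W a k * (W b j * qShift N (h (N ∸ j)) M k)))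
    ≡⟨ sumTo-cong N (λ j j≤N → sumTo-cong M (λ k _ →
         trans (x∙yz≈yx∙z (W a k) (W b j) _) (cong (W b j * W a k *_) (guard {k = k} j≤N)))) ⟩
  peel N M a b h N M ∎
  where
  open ≡-Reasoning
  N = suc n
  a = suc a'
  b = suc b'
  G = yPow b ⊛ h
  first-factor : ∀ m → G N m ≡ sumTo N (λ j → W b j * h (N ∸ j) m)
  first-factor m = trans (⊛-congˡ h (yPow-tSeries b') N m) (tSeries-⊛ (W b) h N m)
  guard : ∀ {j k} → j ≤ N → qShift N (h (N ∸ j)) M k
            ≡ (if (j ≤ᵇ N) ∧ (k ℕ.* N ≤ᵇ M) then h (N ∸ j) (M ∸ k ℕ.* N) else 0ℚ)
  guard j≤N rewrite ≤ᵇ-true j≤N = refl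

Σl : ∀ {A : Set} → List A → (A → ℚ) → ℚ
Σl xs f = sumList (map f xs)

sumList-++ : ∀ xs ys → sumList (xs ++ ys) ≡ sumList xs + sumList ys
sumList-++ []       ys = sym (QP.+-identityˡ (sumList ys))
sumList-++ (x ∷ xs) ys =
  trans (cong (x +_) (sumList-++ xs ys)) (sym (QP.+-assoc x (sumList xs) (sumList ys)))

sumList-concatMap : ∀ {A : Set} (h : A → List ℚ) xs →
  sumList (concatMap h xs) ≡ Σl xs (λ x → sumList (h x))
sumList-concatMap h []       = refl
sumList-concatMap h (x ∷ xs) =
  trans (sumList-++ (h x) (concatMap h xs)) (cong (sumList (h x) +_) (sumList-concatMap h xs))

Σl-concatMap : ∀ {A B : Set} (h : A → List B) xs (g : B → ℚ) →
  Σl (concatMap h xs) g ≡ Σl xs (λ x → Σl (h x) g)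
Σl-concatMap h xs g =
  trans (cong sumList (LP.map-concatMap g h xs)) (sumList-concatMap (λ x → map g (h x)) xs)

Σl-map : ∀ {A B : Set} (k : A → B) xs (f : B → ℚ) → Σl (map k xs) f ≡ Σl xs (λ x → f (k x))
Σl-map k xs f = cong sumList (sym (LP.map-∘ xs))

Σl-cong : ∀ {A : Set} (xs : List A) {f g : A → ℚ} → (∀ x → f x ≡ g x) → Σl xs f ≡ Σl xs g
Σl-cong xs f≗g = cong sumList (LP.map-cong f≗g xs)

Σl-*-if : ∀ {A : Set} (xs : List A) c b (f : A → ℚ) →
  Σl xs (λ x → c * (if b then f x else 0ℚ)) ≡ c * (if b then Σl xs f else 0ℚ)
Σl-*-if []       c true  f = sym (QP.*-zeroʳ c)
Σl-*-if []       c false f = sym (QP.*-zeroʳ c)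
Σl-*-if (x ∷ xs) c b f = begin
  c * (if b then f x else 0ℚ) + Σl xs (λ x → c * (if b then f x else 0ℚ))
    ≡⟨ cong (c * (if b then f x else 0ℚ) +_) (Σl-*-if xs c b f) ⟩
  c * (if b then f x else 0ℚ) + c * (if b then Σl xs f else 0ℚ)
    ≡⟨ QP.*-distribˡ-+ c _ _ ⟨
  c * ((if b then f x else 0ℚ) + (if b then Σl xs f else 0ℚ))
    ≡⟨ cong (c *_) (guards b) ⟩
  c * (if b then f x + Σl xs f else 0ℚ) ∎
  where
  open ≡-Reasoning
  guards : ∀ b → (if b then f x else 0ℚ) + (if b then Σl xs f else 0ℚ) ≡ (if b then f x + Σl xs f else 0ℚ)
  guards true  = refl
  guards false = QP.+-identityʳ 0ℚ

Σl-sumTo : ∀ {A : Set} (xs : List A) n (g : A → ℕ → ℚ) →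
  Σl xs (λ x → sumTo n (g x)) ≡ sumTo n (λ i → Σl xs (λ x → g x i))
Σl-sumTo []       n g = sym (sumTo-zero n (λ _ _ → refl))
Σl-sumTo (x ∷ xs) n g = trans (cong (sumTo n (g x) +_) (Σl-sumTo xs n g))
  (sym (sumTo-+ n (g x) (λ i → Σl xs (λ x → g x i))))

Σl-applyUpTo : ∀ n (h : ℕ → ℕ) (f : ℕ → ℚ) → Σl (applyUpTo h (suc n)) f ≡ sumTo n (λ i → f (h i))
Σl-applyUpTo zero    h f = QP.+-identityʳ (f (h 0))
Σl-applyUpTo (suc n) h f = trans (cong (f (h 0) +_) (Σl-applyUpTo n (λ i → h (suc i)) f))
  (sym (sumTo-head n (λ i → f (h i))))

tuples-Σ : ∀ l B (g : List ℕ → ℚ) →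
  Σl (tuples (suc l) B) g ≡ sumTo B (λ x → Σl (tuples l B) (λ xs → g (x ∷ xs)))
tuples-Σ l B g = begin
  Σl (concatMap (λ x → map (x ∷_) (tuples l B)) (L.upTo (suc B))) g
    ≡⟨ Σl-concatMap (λ x → map (x ∷_) (tuples l B)) (L.upTo (suc B)) g ⟩
  Σl (L.upTo (suc B)) (λ x → Σl (map (x ∷_) (tuples l B)) g)
    ≡⟨ Σl-cong (L.upTo (suc B)) (λ x → Σl-map (x ∷_) (tuples l B) g) ⟩
  Σl (L.upTo (suc B)) (λ x → Σl (tuples l B) (λ xs → g (x ∷ xs)))
    ≡⟨ Σl-applyUpTo B (λ i → i) (λ x → Σl (tuples l B) (λ xs → g (x ∷ xs))) ⟩
  sumTo B (λ x → Σl (tuples l B) (λ xs → g (x ∷ xs))) ∎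
  where open ≡-Reasoning

rhsTerm : List (ℕ × ℕ) → ℕ → ℕ → List ℕ → List ℕ → ℚ
rhsTerm ps N M js ks = if (sumℕ js ≡ᵇ N) ∧ (expQ js ks ≡ᵇ M) then weight ps js ks else 0ℚ

rhsBounded : List (ℕ × ℕ) → ℕ → ℕ → Series
rhsBounded ps A B N M =
  Σl (tuples (L.length ps) A) (λ js → Σl (tuples (L.length ps) B) (rhsTerm ps N M js))

rhs-bounded : ∀ ps N M → rhs ps N M ≡ rhsBounded ps N M N M
rhs-bounded ps N M = sumList-concatMap _ (tuples (L.length ps) N)

degree-cons : ∀ j s k e N M →
  ((j ℕ.+ s ≡ᵇ N) ∧ (k ℕ.* (j ℕ.+ s) ℕ.+ e ≡ᵇ M))
    ≡ (((j ≤ᵇ N) ∧ (k ℕ.* N ≤ᵇ M)) ∧ ((s ≡ᵇ N ∸ j) ∧ (e ≡ᵇ M ∸ k ℕ.* N)))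
degree-cons j s k e N M = does-⇔ (mk⇔ split join)
  ((j ℕ.+ s ℕP.≟ N) ×-dec (k ℕ.* (j ℕ.+ s) ℕ.+ e ℕP.≟ M))
  (((j ℕP.≤? N) ×-dec (k ℕ.* N ℕP.≤? M)) ×-dec ((s ℕP.≟ N ∸ j) ×-dec (e ℕP.≟ M ∸ k ℕ.* N)))
  where
  split : j ℕ.+ s ≡ N × k ℕ.* (j ℕ.+ s) ℕ.+ e ≡ M →
          (j ≤ N × k ℕ.* N ≤ M) × (s ≡ N ∸ j × e ≡ M ∸ k ℕ.* N)
  split (refl , refl) = (ℕP.m≤m+n j s , ℕP.m≤m+n (k ℕ.* (j ℕ.+ s)) e)
                      , (sym (ℕP.m+n∸m≡n j s) , sym (ℕP.m+n∸m≡n (k ℕ.* (j ℕ.+ s)) e))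
  join : (j ≤ N × k ℕ.* N ≤ M) × (s ≡ N ∸ j × e ≡ M ∸ k ℕ.* N) →
         j ℕ.+ s ≡ N × k ℕ.* (j ℕ.+ s) ℕ.+ e ≡ M
  join ((j≤N , kN≤M) , (refl , refl)) =
    ℕP.m+[n∸m]≡n j≤N
    , trans (cong (λ z → k ℕ.* z ℕ.+ (M ∸ k ℕ.* N)) (ℕP.m+[n∸m]≡n j≤N)) (ℕP.m+[n∸m]≡n kN≤M)

rhsTerm-cons : ∀ a b ps N M j k js ks →
  rhsTerm ((a , b) ∷ ps) N M (j ∷ js) (k ∷ ks)
    ≡ (W b j * W a k) *
      (if (j ≤ᵇ N) ∧ (k ℕ.* N ≤ᵇ M) then rhsTerm ps (N ∸ j) (M ∸ k ℕ.* N) js ks else 0ℚ)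
rhsTerm-cons a b ps N M j k js ks = begin
  rhsTerm ((a , b) ∷ ps) N M (j ∷ js) (k ∷ ks)
    ≡⟨ cong₂ (λ c x → if c then x else 0ℚ) (degree-cons j (sumℕ js) k (expQ js ks) N M)
                                           (weight-cons a b ps j k js ks) ⟩
  (if fits ∧ tail then c * weight ps js ks else 0ℚ)
    ≡⟨ if-∧ fits tail (c * weight ps js ks) ⟩
  (if fits then (if tail then c * weight ps js ks else 0ℚ) else 0ℚ)
    ≡⟨ cong (λ z → if fits then z else 0ℚ) (*-if c tail (weight ps js ks)) ⟨
  (if fits then c * (if tail then weight ps js ks else 0ℚ) else 0ℚ)
    ≡⟨ *-if c fits (if tail then weight ps js ks else 0ℚ) ⟨
  c * (if fits then rhsTerm ps (N ∸ j) (M ∸ k ℕ.* N) js ks else 0ℚ) ∎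
  where
  open ≡-Reasoning
  c = W b j * W a k
  fits = (j ≤ᵇ N) ∧ (k ℕ.* N ≤ᵇ M)
  tail = (sumℕ js ≡ᵇ N ∸ j) ∧ (expQ js ks ≡ᵇ M ∸ k ℕ.* N)

rhsBounded-peel : ∀ a b ps A B N M →
  rhsBounded ((a , b) ∷ ps) A B N M ≡ peel A B a b (rhsBounded ps A B) N M
rhsBounded-peel a b ps A B N M = begin
  Σl (tuples (suc l) A) (λ js → Σl (tuples (suc l) B) (rhsTerm P N M js))
    ≡⟨ Σl-cong (tuples (suc l) A) (λ js → tuples-Σ l B (rhsTerm P N M js)) ⟩
  Σl (tuples (suc l) A) (λ js → sumTo B (λ k → Σl TB (λ ks → rhsTerm P N M js (k ∷ ks))))
    ≡⟨ tuples-Σ l A _ ⟩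
  sumTo A (λ j → Σl TA (λ js → sumTo B (λ k → Σl TB (λ ks → rhsTerm P N M (j ∷ js) (k ∷ ks)))))
    ≡⟨ sumTo-cong A (λ j _ → Σl-sumTo TA B _) ⟩
  sumTo A (λ j → sumTo B (λ k → Σl TA (λ js → Σl TB (λ ks → rhsTerm P N M (j ∷ js) (k ∷ ks)))))
    ≡⟨ sumTo-cong A (λ j _ → sumTo-cong B (λ k _ → factor j k)) ⟩
  peel A B a b (rhsBounded ps A B) N M ∎
  where
  open ≡-Reasoning
  P = (a , b) ∷ ps
  l = L.length ps
  TA = tuples l A
  TB = tuples l B
  factor : ∀ j k → Σl TA (λ js → Σl TB (λ ks → rhsTerm P N M (j ∷ js) (k ∷ ks)))
    ≡ (W b j * W a k) *
      (if (j ≤ᵇ N) ∧ (k ℕ.* N ≤ᵇ M) then rhsBounded ps A B (N ∸ j) (M ∸ k ℕ.* N) else 0ℚ)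
  factor j k = trans
    (Σl-cong TA (λ js → trans (Σl-cong TB (rhsTerm-cons a b ps N M j k js))
                              (Σl-*-if TB c fits (rhsTerm ps (N ∸ j) (M ∸ k ℕ.* N) js))))
    (Σl-*-if TA c fits (λ js → Σl TB (rhsTerm ps (N ∸ j) (M ∸ k ℕ.* N) js)))
    where
    c = W b j * W a k
    fits = (j ≤ᵇ N) ∧ (k ℕ.* N ≤ᵇ M)

-- For b ≥ 1 the bounds of the recursion may be shrunk to (N, M): indices
-- j > N fail the guard, and for k > M either kN > M or N = 0, where W b 0 = 0.
peel-shrink : ∀ A B a b' (h : Series) N M → N ≤ A → M ≤ B →
  peel A B a (suc b') h N M ≡ peel N M a (suc b') h N M
peel-shrink A B a b' h N M N≤A M≤B =
  trans (sumTo-extend A _ N≤A (λ j N<j _ → sumTo-zero B (λ k _ → large-j j k N<j)))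
        (sumTo-cong N (λ j j≤N → sumTo-extend B _ M≤B (λ k M<k _ → large-k N j k j≤N M<k)))
  where
  large-j : ∀ j k → N < j → (W (suc b') j * W a k) *
    (if (j ≤ᵇ N) ∧ (k ℕ.* N ≤ᵇ M) then h (N ∸ j) (M ∸ k ℕ.* N) else 0ℚ) ≡ 0ℚ
  large-j j k N<j rewrite ≤ᵇ-false N<j = QP.*-zeroʳ (W (suc b') j * W a k)
  large-k : ∀ N j k → j ≤ N → M < k → (W (suc b') j * W a k) *
    (if (j ≤ᵇ N) ∧ (k ℕ.* N ≤ᵇ M) then h (N ∸ j) (M ∸ k ℕ.* N) else 0ℚ) ≡ 0ℚ
  large-k zero    .zero k z≤n _   =
    trans (cong (_* qShift 0 (h 0) M k) (QP.*-zeroˡ (W a k))) (QP.*-zeroˡ (qShift 0 (h 0) M k))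
  large-k (suc n) j     k j≤N M<k
    rewrite ≤ᵇ-true j≤N | ≤ᵇ-false (ℕP.<-≤-trans M<k (ℕP.m≤m*n k (suc n))) =
    QP.*-zeroʳ (W (suc b') j * W a k)

peel-cong : ∀ A B a b (h h' : Series) N M → (∀ n m → n ≤ N → m ≤ M → h n m ≡ h' n m) →
  peel A B a b h N M ≡ peel A B a b h' N M
peel-cong A B a b h h' N M h≗h' = sumTo-cong A (λ j _ → sumTo-cong B (λ k _ →
  cong (λ z → (W b j * W a k) * (if (j ≤ᵇ N) ∧ (k ℕ.* N ≤ᵇ M) then z else 0ℚ))
       (h≗h' (N ∸ j) (M ∸ k ℕ.* N) (ℕP.m∸n≤m N j) (ℕP.m∸n≤m M (k ℕ.* N)))))

rhsBounded≡lhs : ∀ ps → All (λ p → 1 ≤ proj₁ p × 1 ≤ proj₂ p) ps →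
  ∀ A B N M → N ≤ A → M ≤ B →
  rhsBounded ps A B N M ≡ lhs ps N M
rhsBounded≡lhs [] _ A B zero    zero    _ _ = refl
rhsBounded≡lhs [] _ A B zero    (suc M) _ _ = refl
rhsBounded≡lhs [] _ A B (suc N) M       _ _ = refl
rhsBounded≡lhs ((suc a' , suc b') ∷ ps) ((s≤s z≤n , s≤s z≤n) ∷ positive) A B N M N≤A M≤B = begin
  rhsBounded ((suc a' , suc b') ∷ ps) A B N M
    ≡⟨ rhsBounded-peel (suc a') (suc b') ps A B N M ⟩
  peel A B (suc a') (suc b') (rhsBounded ps A B) N M
    ≡⟨ peel-shrink A B (suc a') b' (rhsBounded ps A B) N M N≤A M≤B ⟩
  peel N M (suc a') (suc b') (rhsBounded ps A B) N M
    ≡⟨ peel-cong N M (suc a') (suc b') (rhsBounded ps A B) (lhs ps) N M (λ n m n≤N m≤M →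
         rhsBounded≡lhs ps positive A B n m (ℕP.≤-trans n≤N N≤A) (ℕP.≤-trans m≤M M≤B)) ⟩
  peel N M (suc a') (suc b') (lhs ps) N M
    ≡⟨ lhs-peel a' b' (lhs ps) N M ⟨
  lhs ((suc a' , suc b') ∷ ps) N M ∎
  where open ≡-Reasoning

theorem3p3 : (ps : List (ℕ × ℕ)) → ps ≢ [] →
    All (λ p → 1 ≤ proj₁ p × 1 ≤ proj₂ p) ps →
    (N M : ℕ) → lhs ps N M ≡ rhs ps N M
theorem3p3 ps _ positive N M = begin
  lhs ps N M             ≡⟨ rhsBounded≡lhs ps positive N M N M ℕP.≤-refl ℕP.≤-refl ⟨
  rhsBounded ps N M N M  ≡⟨ rhs-bounded ps N M ⟨
  rhs ps N M             ∎
  where open ≡-Reasoning
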